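{- For every simplicial complex $X$, $\theta(X)\leq\mathrm{ccn}(X)$.
   Context: A simplicial complex $X$ on a finite set $V$ is a family of subsets of $V$ closed under taking subsets; its vertices are those $v$ with $\{v\}\in X$. For a vertex $v$, $\mathrm{del}(X;v)=\{S\in X:v\notin S\}$, $\mathrm{lk}(X;v)=\{T\in X:v\notin T,\ T\cup\{v\}\in X\}$; $v$ is a cone vertex if $\mathrm{lk}(X;v)=\mathrm{del}(X;v)$, and $V(X)^\circ$ is the set of non-cone vertices. Theta-number: $\theta(X)=0$ if $V(X)^\circ=\emptyset$, otherwise $\theta(X)=\min_{v\in V(X)^\circ}\max\{\theta(\mathrm{del}(X;v)),\theta(\mathrm{lk}(X;v))+1\}$. For $S\subseteq V$, $X[S]=\{A\in X:A\subseteq S\}$; the dimension of a complex is the maximum of $|A|-1$ over its faces $A$. A circuit (minimal non-face) of $X$ is a subset $S\subseteq V$ with $S\notin X$ but every proper subset of $S$ in $X$. A subset $C\subseteq V$ is a circuit cover of $X$ if $|S\cap C|\geq|S|-1$ for every circuit $S$ of $X$. The circuit cover number is $\mathrm{ccn}(X)=\min\{\dim(X[C]) : C \text{ a circuit cover of } X\}+1$. -}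

module Defs where

open import Data.Nat using (ℕ; zero; suc; _+_; _≤_; _⊔_; _⊓_; _≤ᵇ_)
open import Data.Bool using (Bool; true; false; not; _∧_; _∨_; _xor_; _≟_)
open import Data.List.Base using (List; []; _∷_; map; _++_; filter; foldr)
open import Data.Vec using (Vec; []; _∷_; lookup; _[_]≔_)
open import Data.Fin using (Fin)
open import Data.Fin.Subset using (Subset; _⊆_; ∣_∣; ⁅_⁆; _∩_)
open import Data.Fin.Subset.Properties using (_⊆?_)
open import Data.List.Base using (allFin)
open import Relation.Nullary.Decidable using (⌊_⌋)
open import Relation.Binary.PropositionalEquality using (_≡_)

-- Ground set V = Fin n; subsets of V are Subset n = Vec Bool n.
-- A family of subsets of V is given by its (decidable) characteristic function.
Family : ℕ → Set
Family n = Subset n → Bool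

IsComplex : ∀ {n} → Family n → Set
IsComplex {n} X = ∀ (A B : Subset n) → B ⊆ A → X A ≡ true → X B ≡ true

all : ∀ {A : Set} → (A → Bool) → List A → Bool
all p [] = true
all p (x ∷ xs) = p x ∧ all p xs

allSubsets : ∀ n → List (Subset n)
allSubsets zero = [] ∷ []
allSubsets (suc n) = map (true ∷_) (allSubsets n) ++ map (false ∷_) (allSubsets n)

_==ᴮ_ : Bool → Bool → Bool
a ==ᴮ b = not (a xor b)

_⊆ᵇ_ : ∀ {n} → Subset n → Subset n → Bool
A ⊆ᵇ B = ⌊ A ⊆? B ⌋

_=ˢ_ : ∀ {n} → Subset n → Subset n → Bool
A =ˢ B = (A ⊆ᵇ B) ∧ (B ⊆ᵇ A)

del : ∀ {n} → Family n → Fin n → Family n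
del X v S = not (lookup S v) ∧ X S

-- lk(X;v) = {T ∈ X : v ∉ T, T ∪ {v} ∈ X}   (T ∈ X follows from T ∪ {v} ∈ X for complexes,
-- but we keep it literally)
lk : ∀ {n} → Family n → Fin n → Family n
lk X v T = not (lookup T v) ∧ X T ∧ X (T [ v ]≔ true)

isVertex : ∀ {n} → Family n → Fin n → Bool
isVertex X v = X ⁅ v ⁆

isCone : ∀ {n} → Family n → Fin n → Bool
isCone {n} X v = all (λ S → lk X v S ==ᴮ del X v S) (allSubsets n)

nonConeVertices : ∀ {n} → Family n → List (Fin n)
nonConeVertices {n} X = filter (λ v → isVertex X v ∧ not (isCone X v) ≟ true) (allFin n)

-- minimum of a list of naturals over a nonempty list (0 for the empty list; only used
-- on lists known to be nonempty)
minList : List ℕ → ℕ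
minList [] = 0
minList (x ∷ xs) = foldr _⊓_ x xs

maxList : List ℕ → ℕ
maxList = foldr _⊔_ 0

-- Each step (del or lk at a vertex v)
-- removes v from the vertex set and adds no new vertices, so a complex on Fin n has
-- recursion depth at most n; with fuel n the fuel never runs out before V(X)° = ∅.
θ-fuel : ∀ {n} → ℕ → Family n → ℕ
θ-fuel zero X = 0
θ-fuel (suc k) X with nonConeVertices X
... | [] = 0
... | vs@(_ ∷ _) = minList (map (λ v → θ-fuel k (del X v) ⊔ suc (θ-fuel k (lk X v))) vs)

θ : ∀ {n} → Family n → ℕ
θ {n} X = θ-fuel n X

isCircuit : ∀ {n} → Family n → Subset n → Bool
isCircuit {n} X S =
  not (X S) ∧ all (λ B → not ((B ⊆ᵇ S) ∧ not (B =ˢ S)) ∨ X B) (allSubsets n)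

-- C is a circuit cover: |S ∩ C| ≥ |S| - 1, i.e. |S| ≤ |S ∩ C| + 1, for every circuit S
isCircuitCover : ∀ {n} → Family n → Subset n → Bool
isCircuitCover {n} X C =
  all (λ S → not (isCircuit X S) ∨ (∣ S ∣ ≤ᵇ suc ∣ S ∩ C ∣)) (allSubsets n)

-- dim(X[C]) + 1 = max{|A| : A ∈ X, A ⊆ C}  (0 when X[C] has no nonempty face,
-- i.e. dim = -1)
dimPlusOne : ∀ {n} → Family n → Subset n → ℕ
dimPlusOne {n} X C = maxList (map ∣_∣ (filter (λ A → (X A ∧ (A ⊆ᵇ C)) ≟ true) (allSubsets n)))

-- ccn(X) = min{dim(X[C]) : C circuit cover} + 1  (V itself is always a circuit cover,
-- so the minimum is over a nonempty list)
ccn : ∀ {n} → Family n → ℕ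
ccn {n} X = minList (map (dimPlusOne X) (filter (λ C → isCircuitCover X C ≟ true) (allSubsets n)))

-- Induction on the recursion defining θ, for a fixed circuit cover C of dimension d.  If X has
-- a non-cone vertex, it lies on a circuit A with |A| ≥ 2; since |A ∩ C| ≥ |A| - 1 ≥ 1, some
-- u ∈ A ∩ C, and every vertex of such a circuit is a non-cone vertex.  Branching at u, C is still
-- a circuit cover of del(X;u) of dimension ≤ d, and C - u is one of lk(X;u) of dimension ≤ d - 1
-- (a circuit S of the link is either a circuit of X, or S ∪ {u} is one).  Hence θ(X) ≤ d + 1.
module Submission where

open import Defs
open import Data.Bool as Bool using (Bool; true; false; not; _∧_; _∨_)
open import Data.Bool.Properties using (∧-conicalˡ; ∧-conicalʳ; ∨-zeroʳ; ¬-not; not-injective; T-≡)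
open import Data.Fin using (Fin; zero; suc)
open import Data.Fin.Properties using (_≟_)
open import Data.Fin.Subset
  using (Subset; inside; outside; _∈_; _∉_; _⊆_; _⊂_; ∣_∣; ⁅_⁆; _∩_; ⊤; Nonempty)
open import Data.Fin.Subset.Properties
  using ( _∈?_; _⊆?_; _⊂?_; ⊆-refl; ⊆-trans; ⊆-antisym; p⊂q⇒p⊆q; p⊆q⇒∣p∣≤∣q∣; p⊂q⇒∣p∣<∣q∣
        ; anySubset?; x∈⁅x⁆; x∈⁅y⁆⇒x≡y; ∣⁅x⁆∣≡1; x∈p∩q⁺; x∈p∩q⁻; ∩-identityʳ
        ; nonempty?; Empty-unique; ∣⊥∣≡0)
open import Data.List.Base using ([]; _∷_; map; filter; allFin)
open import Data.List.Membership.Propositional using () renaming (_∈_ to _∈ˡ_)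
open import Data.List.Membership.Propositional.Properties
  using (∈-map⁺; ∈-map⁻; ∈-filter⁺; ∈-filter⁻; ∈-++⁺ˡ; ∈-++⁺ʳ; ∈-allFin)
open import Data.List.Properties using (foldr-preservesᵇ; foldr-preservesᵒ)
import Data.List.Relation.Unary.All as All
import Data.List.Relation.Unary.Any as Any
open import Data.List.Relation.Unary.Any using (here; there)
open import Data.Nat using (ℕ; zero; suc; _≤_; _<_; _≤ᵇ_; _⊔_; z≤n; s≤s; s≤s⁻¹)
open import Data.Nat.Induction using (<-wellFounded)
open import Data.Nat.Properties
  using ( ≤-refl; ≤-reflexive; ≤-trans; ≤ᵇ⇒≤; ≤⇒≤ᵇ; n≤1+n; <-irrefl; ⊓-glb; ⊔-lub
        ; m≤n⇒m⊓o≤n; m≤n⇒o⊓m≤n; m≤n⇒m≤n⊔o; m≤n⇒m≤o⊔n; module ≤-Reasoning)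
open import Data.Product using (∃-syntax; _×_; _,_; proj₁; proj₂)
open import Data.Sum using ([_,_]′; inj₂)
open import Data.Vec using ([]; _∷_; lookup; _[_]≔_; here; there)
open import Data.Vec.Properties
  using ( []≔-updates; []≔-minimal; []≔-idempotent; []≔-lookup; []=-injective
        ; []=⇒lookup; lookup⇒[]=; lookup∘update′)
open import Function using (_∘_; _on_; case_of_)
open import Function.Bundles using (Equivalence)
open import Induction.WellFounded using (Acc; acc)
import Relation.Binary.Construct.On as On
open import Relation.Nullary using (¬_; Dec; yes; no; contradiction)
open import Relation.Nullary.Decidable using (decidable-stable; toWitness; fromWitness; _×-dec_)
open import Relation.Binary.PropositionalEquality using (_≡_; _≢_; refl; sym; trans; cong; cong₂; subst)

private
  variable
    n m : ℕ
    X F : Family n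
    A B C S : Subset n
    u v w x : Fin n

≡true⇒T : ∀ {b} → b ≡ true → Bool.T b
≡true⇒T = Equivalence.from T-≡

minList-≤ : ∀ {x} xs → x ∈ˡ xs → minList xs ≤ x
minList-≤ {x = x} (x₀ ∷ xs) x∈ =
  foldr-preservesᵒ {P = _≤ x} (λ a b → [ m≤n⇒m⊓o≤n b , m≤n⇒o⊓m≤n a ]′) x₀ xs
    (Any.toSum (Any.map (≤-reflexive ∘ sym) x∈))

minList-glb : ∀ {x} xs → x ∈ˡ xs → (∀ {y} → y ∈ˡ xs → m ≤ y) → m ≤ minList xs
minList-glb {m = m} (x₀ ∷ xs) _ bound =
  foldr-preservesᵇ {P = m ≤_} ⊓-glb (bound (here refl)) (All.tabulate (bound ∘ there))

maxList-< : ∀ xs → 0 < m → (∀ {x} → x ∈ˡ xs → x < m) → maxList xs < m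
maxList-< {m = m} xs 0<m bound = foldr-preservesᵇ {P = _< m} ⊔-lub 0<m (All.tabulate bound)

≤-maxList : ∀ {x} xs → x ∈ˡ xs → x ≤ maxList xs
≤-maxList {x = x} xs x∈xs =
  foldr-preservesᵒ {P = x ≤_} (λ a b → [ m≤n⇒m≤n⊔o b , m≤n⇒m≤o⊔n a ]′) 0 xs
    (inj₂ (Any.map ≤-reflexive x∈xs))

all-sound : ∀ {E : Set} {p : E → Bool} {xs e} → all p xs ≡ true → e ∈ˡ xs → p e ≡ true
all-sound {p = p} {x ∷ xs} holds (here refl) = ∧-conicalˡ _ _ holds
all-sound {p = p} {x ∷ xs} holds (there e∈xs) = all-sound (∧-conicalʳ (p x) _ holds) e∈xs

all-true : ∀ {E : Set} {p : E → Bool} xs → (∀ e → p e ≡ true) → all p xs ≡ true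
all-true [] _ = refl
all-true (x ∷ xs) holds rewrite holds x = all-true xs holds

all-false : ∀ {E : Set} {p : E → Bool} xs → all p xs ≡ false → ∃[ e ] p e ≡ false
all-false {p = p} (x ∷ xs) fails with p x in px
... | false = x , px
... | true = all-false xs fails

∈-allSubsets : ∀ (A : Subset n) → A ∈ˡ allSubsets n
∈-allSubsets [] = here refl
∈-allSubsets (true ∷ A) = ∈-++⁺ˡ (∈-map⁺ (true ∷_) (∈-allSubsets A))
∈-allSubsets {suc n} (false ∷ A) =
  ∈-++⁺ʳ (map (true ∷_) (allSubsets n)) (∈-map⁺ (false ∷_) (∈-allSubsets A))

lookup-∉ : x ∉ A → lookup A x ≡ false
lookup-∉ {x = x} {A} x∉A with lookup A x in eq
... | false = refl
... | true = contradiction (lookup⇒[]= x A eq) x∉A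

lookup-∈ : x ∈ A → lookup A x ≡ true
lookup-∈ = []=⇒lookup

∈-update⁺ : ∀ {b} → x ≢ u → x ∈ A → x ∈ A [ u ]≔ b
∈-update⁺ {x = x} {u} {A} = []≔-minimal A x u

∈-update⁻ : ∀ {b} → x ≢ u → x ∈ A [ u ]≔ b → x ∈ A
∈-update⁻ {x = x} {A = A} x≢u x∈A′ =
  lookup⇒[]= x A (trans (sym (lookup∘update′ x≢u A _)) ([]=⇒lookup x∈A′))

∈-insert : u ∈ A [ u ]≔ inside
∈-insert {u = u} {A} = []≔-updates A u

∉-remove : u ∉ A [ u ]≔ outside
∉-remove {u = u} {A} u∈ = case []=-injective u∈ ([]≔-updates A u) of λ ()

insert-remove : u ∈ A → (A [ u ]≔ outside) [ u ]≔ inside ≡ A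
insert-remove {u = u} {A} u∈A = trans ([]≔-idempotent A u)
  (subst (λ b → A [ u ]≔ b ≡ A) (lookup-∈ u∈A) ([]≔-lookup A u))

remove-⊂ : u ∈ A → A [ u ]≔ outside ⊂ A
remove-⊂ {u = u} {A = A} u∈A = remove-⊆ , u , u∈A , ∉-remove
  where
  remove-⊆ : A [ u ]≔ outside ⊆ A
  remove-⊆ {x} x∈ with x ≟ u
  ... | yes refl = contradiction x∈ ∉-remove
  ... | no x≢u = ∈-update⁻ x≢u x∈

⊆-insert⁻ : A ⊆ B [ u ]≔ inside → u ∉ A → A ⊆ B
⊆-insert⁻ {u = u} A⊆B′ u∉A {x} x∈A with x ≟ u
... | yes refl = contradiction x∈A u∉A
... | no x≢u = ∈-update⁻ x≢u (A⊆B′ x∈A)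

insert-mono : A ⊆ B → A [ u ]≔ inside ⊆ B [ u ]≔ inside
insert-mono {u = u} A⊆B {x} x∈ with x ≟ u
... | yes refl = ∈-insert
... | no x≢u = ∈-update⁺ x≢u (A⊆B (∈-update⁻ x≢u x∈))

∩-remove⁺ : u ∉ A → A ∩ C ⊆ A ∩ (C [ u ]≔ outside)
∩-remove⁺ {A = A} {C = C} u∉A x∈ with x∈p∩q⁻ A C x∈
... | x∈A , x∈C = x∈p∩q⁺ (x∈A , ∈-update⁺ (λ { refl → u∉A x∈A }) x∈C)

insert-∩-⊆ : (A [ u ]≔ inside) ∩ C ⊆ (A ∩ (C [ u ]≔ outside)) [ u ]≔ inside
insert-∩-⊆ {A = A} {u = u} {C = C} {x} x∈ with x ≟ u | x∈p∩q⁻ (A [ u ]≔ inside) C x∈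
... | yes refl | _ = ∈-insert
... | no x≢u | x∈A+u , x∈C =
  ∈-update⁺ x≢u (x∈p∩q⁺ (∈-update⁻ x≢u x∈A+u , ∈-update⁺ x≢u x∈C))

x∈p⇒⁅x⁆⊆p : x ∈ A → ⁅ x ⁆ ⊆ A
x∈p⇒⁅x⁆⊆p {x = x} x∈A y∈⁅x⁆ = subst (_∈ _) (sym (x∈⁅y⁆⇒x≡y x y∈⁅x⁆)) x∈A

⊆∧⊉⇒⊂ : A ⊆ B → ¬ B ⊆ A → A ⊂ B
⊆∧⊉⇒⊂ {A = A} {B} A⊆B B⊈A = decidable-stable (A ⊂? B) λ A⊄B →
  B⊈A λ {x} x∈B → decidable-stable (x ∈? A) λ x∉A → A⊄B (A⊆B , x , x∈B , x∉A)

⊆∧≢⇒⊂ : A ⊆ B → A ≢ B → A ⊂ B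
⊆∧≢⇒⊂ A⊆B A≢B = ⊆∧⊉⇒⊂ A⊆B (A≢B ∘ ⊆-antisym A⊆B)

∣insert∣ : ∀ (A : Subset n) → u ∉ A → ∣ A [ u ]≔ inside ∣ ≡ suc ∣ A ∣
∣insert∣ {u = zero} (outside ∷ A) _ = refl
∣insert∣ {u = zero} (inside ∷ A) u∉A = contradiction here u∉A
∣insert∣ {u = suc u} (outside ∷ A) u∉A = ∣insert∣ A (u∉A ∘ there)
∣insert∣ {u = suc u} (inside ∷ A) u∉A = cong suc (∣insert∣ A (u∉A ∘ there))

IsCircuit : Family n → Subset n → Set
IsCircuit X S = X S ≡ false × (∀ {B} → B ⊂ S → X B ≡ true)

IsCircuitCover : Family n → Subset n → Set
IsCircuitCover X C = ∀ {S} → IsCircuit X S → ∣ S ∣ ≤ suc ∣ S ∩ C ∣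

IsCircuit⇒isCircuit : {X : Family n} → IsCircuit X S → isCircuit X S ≡ true
IsCircuit⇒isCircuit {n = n} {S = S} {X = X} (XS , proper) rewrite XS = all-true (allSubsets n) entry
  where
  entry : ∀ B → (not ((B ⊆ᵇ S) ∧ not (B =ˢ S)) ∨ X B) ≡ true
  entry B with B ⊆? S | S ⊆? B
  ... | no _ | _ = refl
  ... | yes _ | yes _ = refl
  ... | yes B⊆S | no S⊈B = proper (⊆∧⊉⇒⊂ B⊆S S⊈B)

isCircuitCover⇒IsCircuitCover : isCircuitCover X C ≡ true → IsCircuitCover X C
isCircuitCover⇒IsCircuitCover {X = X} {C = C} cover {S} circuit =
  ≤ᵇ⇒≤ _ _ (≡true⇒T (subst (λ b → (not b ∨ (∣ S ∣ ≤ᵇ suc ∣ S ∩ C ∣)) ≡ true)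
                             (IsCircuit⇒isCircuit circuit) (all-sound cover (∈-allSubsets S))))

isCircuitCover-⊤ : {X : Family n} → isCircuitCover X ⊤ ≡ true
isCircuitCover-⊤ {n = n} {X = X} = all-true (allSubsets n) λ S →
  trans (cong (not (isCircuit X S) ∨_) (Equivalence.to T-≡ (≤⇒≤ᵇ (size-bound S)))) (∨-zeroʳ _)
  where
  size-bound : ∀ S → ∣ S ∣ ≤ suc ∣ S ∩ ⊤ ∣
  size-bound S = subst (λ T → ∣ S ∣ ≤ suc ∣ T ∣) (sym (∩-identityʳ S)) (n≤1+n _)

non-face⇒⊇circuit : ∀ B → X B ≡ false → ∃[ A ] A ⊆ B × IsCircuit X A
non-face⇒⊇circuit {X = X} B = go B (On.wellFounded ∣_∣ <-wellFounded B)
  where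
  go : ∀ B → Acc (_<_ on ∣_∣) B → X B ≡ false → ∃[ A ] A ⊆ B × IsCircuit X A
  go B (acc smaller) XB with anySubset? (λ A → A ⊂? B ×-dec X A Bool.≟ false)
  ... | yes (A , A⊂B , XA) with go A (smaller (p⊂q⇒∣p∣<∣q∣ A⊂B)) XA
  ...   | A′ , A′⊆A , circuit = A′ , ⊆-trans A′⊆A (p⊂q⇒p⊆q A⊂B) , circuit
  go B (acc smaller) XB | no none = B , ⊆-refl , XB , λ A⊂B → ¬-not λ XA → none (_ , A⊂B , XA)

non-vertex∈circuit⇒∣circuit∣≤1 : X ⁅ v ⁆ ≡ false → IsCircuit X S → v ∈ S → ∣ S ∣ ≤ 1
non-vertex∈circuit⇒∣circuit∣≤1 {v = v} {S = S} X⁅v⁆ (_ , proper) v∈S = begin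
  ∣ S ∣     ≤⟨ p⊆q⇒∣p∣≤∣q∣ S⊆⁅v⁆ ⟩
  ∣ ⁅ v ⁆ ∣ ≡⟨ ∣⁅x⁆∣≡1 v ⟩
  1         ∎
  where
  open ≤-Reasoning
  S⊆⁅v⁆ : S ⊆ ⁅ v ⁆
  S⊆⁅v⁆ = decidable-stable (S ⊆? ⁅ v ⁆) λ S⊈⁅v⁆ →
    case trans (sym (proper (⊆∧⊉⇒⊂ (x∈p⇒⁅x⁆⊆p v∈S) S⊈⁅v⁆))) X⁅v⁆ of λ ()

circuit-of-subfamily : (∀ {A} → F A ≡ true → X A ≡ true) → X S ≡ false →
                       IsCircuit F S → IsCircuit X S
circuit-of-subfamily F⊆X XS (_ , proper) = XS , F⊆X ∘ proper

del-∉ : ∀ X → v ∉ A → del X v A ≡ X A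
del-∉ _ v∉A rewrite lookup-∉ v∉A = refl

del-∋ : ∀ X → v ∈ A → del X v A ≡ false
del-∋ _ v∈A rewrite lookup-∈ v∈A = refl

del-face⁻ : ∀ X → del X v A ≡ true → v ∉ A × X A ≡ true
del-face⁻ {v = v} {A = A} X face = v∉A , ∧-conicalʳ _ _ face
  where
  v∉A : v ∉ A
  v∉A v∈A = case trans (sym face) (del-∋ X v∈A) of λ ()

lk-∉ : ∀ X → v ∉ A → lk X v A ≡ X A ∧ X (A [ v ]≔ inside)
lk-∉ _ v∉A rewrite lookup-∉ v∉A = refl

lk-∋ : ∀ X → v ∈ A → lk X v A ≡ false
lk-∋ _ v∈A rewrite lookup-∈ v∈A = refl

lk-face⁻ : ∀ X → lk X v A ≡ true → v ∉ A × X A ≡ true × X (A [ v ]≔ inside) ≡ true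
lk-face⁻ {v = v} {A = A} X face = v∉A , ∧-conicalˡ _ _ faces , ∧-conicalʳ (X A) _ faces
  where
  v∉A : v ∉ A
  v∉A v∈A = case trans (sym face) (lk-∋ X v∈A) of λ ()
  faces : X A ∧ X (A [ v ]≔ inside) ≡ true
  faces = trans (sym (lk-∉ X v∉A)) face

del-isComplex : IsComplex X → IsComplex (del X v)
del-isComplex {X = X} {v = v} complex A B B⊆A face with v ∈? B
... | yes v∈B = contradiction (B⊆A v∈B) (proj₁ (del-face⁻ X face))
... | no v∉B = trans (del-∉ X v∉B) (complex A B B⊆A (proj₂ (del-face⁻ X face)))

lk-isComplex : IsComplex X → IsComplex (lk X v)
lk-isComplex {X = X} complex A B B⊆A face with lk-face⁻ X face
... | v∉A , XA , XA+v = trans (lk-∉ X (v∉A ∘ B⊆A))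
  (cong₂ _∧_ (complex A B B⊆A XA) (complex _ _ (insert-mono B⊆A) XA+v))

del-isCircuitCover : IsCircuitCover X C → IsCircuitCover (del X v) C
del-isCircuitCover {X = X} {v = v} cover {S} circuit with v ∈? S
... | yes v∈S =
  ≤-trans (non-vertex∈circuit⇒∣circuit∣≤1 (del-∋ X (x∈⁅x⁆ v)) circuit v∈S) (s≤s z≤n)
... | no v∉S =
  cover (circuit-of-subfamily (proj₂ ∘ del-face⁻ X) (trans (sym (del-∉ X v∉S)) (proj₁ circuit))
                              circuit)

lk-circuit⇒insert-circuit : IsComplex X → u ∉ S → X S ≡ true → IsCircuit (lk X u) S →
                            IsCircuit X (S [ u ]≔ inside)
lk-circuit⇒insert-circuit {X = X} {u = u} {S = S} complex u∉S XS (lkS , proper) =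
  trans (cong (_∧ X (S [ u ]≔ inside)) (sym XS)) (trans (sym (lk-∉ X u∉S)) lkS) , face
  where
  face : ∀ {B} → B ⊂ S [ u ]≔ inside → X B ≡ true
  face {B} (B⊆S+u , z , z∈S+u , z∉B) with u ∈? B
  ... | no u∉B = complex S B (⊆-insert⁻ B⊆S+u u∉B) XS
  ... | yes u∈B = subst (λ B′ → X B′ ≡ true) (insert-remove u∈B)
                        (proj₂ (proj₂ (lk-face⁻ X (proper B-u⊂S))))
    where
    z≢u : z ≢ u
    z≢u refl = z∉B u∈B
    B-u⊂S : B [ u ]≔ outside ⊂ S
    B-u⊂S = ⊆-insert⁻ (⊆-trans (p⊂q⇒p⊆q (remove-⊂ u∈B)) B⊆S+u) ∉-remove
          , z , ∈-update⁻ z≢u z∈S+u , z∉B ∘ p⊂q⇒p⊆q (remove-⊂ u∈B)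

lk-isCircuitCover : IsComplex X → IsCircuitCover X C → u ∈ C →
                    IsCircuitCover (lk X u) (C [ u ]≔ outside)
lk-isCircuitCover {X = X} {C = C} {u = u} complex cover u∈C {S} circuit with u ∈? S | X S Bool.≟ true
... | yes u∈S | _ =
  ≤-trans (non-vertex∈circuit⇒∣circuit∣≤1 (lk-∋ X (x∈⁅x⁆ u)) circuit u∈S) (s≤s z≤n)
... | no u∉S | no XS≢true =
  ≤-trans (cover (circuit-of-subfamily (proj₁ ∘ proj₂ ∘ lk-face⁻ X) (¬-not XS≢true) circuit))
          (s≤s (p⊆q⇒∣p∣≤∣q∣ (∩-remove⁺ u∉S)))
... | no u∉S | yes XS = s≤s⁻¹ (begin
  suc ∣ S ∣                       ≡⟨ ∣insert∣ S u∉S ⟨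
  ∣ S [ u ]≔ inside ∣             ≤⟨ cover (lk-circuit⇒insert-circuit complex u∉S XS circuit) ⟩
  suc ∣ (S [ u ]≔ inside) ∩ C ∣   ≤⟨ s≤s (p⊆q⇒∣p∣≤∣q∣ (insert-∩-⊆ {A = S} {u = u} {C = C})) ⟩
  suc ∣ (S ∩ C-u) [ u ]≔ inside ∣ ≡⟨ cong suc (∣insert∣ (S ∩ C-u) u∉S∩C-u) ⟩
  suc (suc ∣ S ∩ C-u ∣)           ∎)
  where
  open ≤-Reasoning
  C-u : Subset _
  C-u = C [ u ]≔ outside
  u∉S∩C-u : u ∉ S ∩ C-u
  u∉S∩C-u = ∉-remove ∘ proj₂ ∘ x∈p∩q⁻ S C-u

faceWithin? : (X : Family n) (C A : Subset n) → Dec ((X A ∧ (A ⊆ᵇ C)) ≡ true)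
faceWithin? X C A = (X A ∧ (A ⊆ᵇ C)) Bool.≟ true

≤-dimPlusOne : ∀ X → X A ≡ true → A ⊆ C → ∣ A ∣ ≤ dimPlusOne X C
≤-dimPlusOne {A = A} {C = C} X XA A⊆C =
  ≤-maxList _ (∈-map⁺ ∣_∣ (∈-filter⁺ (faceWithin? X C) (∈-allSubsets A) within))
  where
  within : (X A ∧ (A ⊆ᵇ C)) ≡ true
  within = cong₂ _∧_ XA (Equivalence.to T-≡ (fromWitness {a? = A ⊆? C} A⊆C))

dimPlusOne-< : ∀ X → 0 < m → (∀ {A} → X A ≡ true → A ⊆ C → ∣ A ∣ < m) → dimPlusOne X C < m
dimPlusOne-< {m = m} {C = C} X 0<m bound = maxList-< _ 0<m size<m
  where
  size<m : ∀ {s} → s ∈ˡ map ∣_∣ (filter (faceWithin? X C) (allSubsets _)) → s < m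
  size<m s∈ with ∈-map⁻ ∣_∣ s∈
  ... | A , A∈ , refl with ∈-filter⁻ (faceWithin? X C) {xs = allSubsets _} A∈
  ... | _ , within =
    bound (∧-conicalˡ _ _ within) (toWitness {a? = A ⊆? C} (≡true⇒T (∧-conicalʳ (X A) _ within)))

del-dimPlusOne-≤ : ∀ X → dimPlusOne (del X v) C ≤ dimPlusOne X C
del-dimPlusOne-≤ X =
  s≤s⁻¹ (dimPlusOne-< (del X _) (s≤s z≤n) λ face A⊆C →
    s≤s (≤-dimPlusOne X (proj₂ (del-face⁻ X face)) A⊆C))

lk-dimPlusOne-< : ∀ X → X ⁅ u ⁆ ≡ true → u ∈ C →
                  dimPlusOne (lk X u) (C [ u ]≔ outside) < dimPlusOne X C
lk-dimPlusOne-< {u = u} {C = C} X X⁅u⁆ u∈C =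
  dimPlusOne-< (lk X u) (subst (_≤ _) (∣⁅x⁆∣≡1 u) (≤-dimPlusOne X X⁅u⁆ (x∈p⇒⁅x⁆⊆p u∈C))) bound
  where
  bound : ∀ {A} → lk X u A ≡ true → A ⊆ C [ u ]≔ outside → ∣ A ∣ < dimPlusOne X C
  bound {A} face A⊆C-u with lk-face⁻ X face
  ... | u∉A , _ , XA+u = subst (_≤ _) (∣insert∣ A u∉A) (≤-dimPlusOne X XA+u A+u⊆C)
    where
    A+u⊆C : A [ u ]≔ inside ⊆ C
    A+u⊆C {x} x∈ with x ≟ u
    ... | yes refl = u∈C
    ... | no x≢u = ∈-update⁻ x≢u (A⊆C-u (∈-update⁻ x≢u x∈))

≤-ccn : (X : Family n) → (∀ {C} → IsCircuitCover X C → m ≤ dimPlusOne X C) → m ≤ ccn X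
≤-ccn {n = n} {m = m} X bound =
  minList-glb _ (∈-map⁺ (dimPlusOne X) (∈-filter⁺ cover? (∈-allSubsets ⊤) (isCircuitCover-⊤ {X = X})))
    m≤
  where
  cover? : ∀ C → Dec (isCircuitCover X C ≡ true)
  cover? C = isCircuitCover X C Bool.≟ true
  m≤ : ∀ {d} → d ∈ˡ map (dimPlusOne X) (filter cover? (allSubsets n)) → m ≤ d
  m≤ d∈ with ∈-map⁻ (dimPlusOne X) d∈
  ... | C , C∈ , refl =
    bound (isCircuitCover⇒IsCircuitCover (proj₂ (∈-filter⁻ cover? {xs = allSubsets n} C∈)))

nonCone? : (X : Family n) (v : Fin n) → Dec ((isVertex X v ∧ not (isCone X v)) ≡ true)
nonCone? X v = isVertex X v ∧ not (isCone X v) Bool.≟ true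

∈-nonConeVertices⁻ : (X : Family n) → v ∈ˡ nonConeVertices X → X ⁅ v ⁆ ≡ true × isCone X v ≡ false
∈-nonConeVertices⁻ {n = n} {v = v} X v∈ with ∈-filter⁻ (nonCone? X) {xs = allFin n} v∈
... | _ , nonCone = ∧-conicalˡ _ _ nonCone , not-injective (∧-conicalʳ (X ⁅ v ⁆) _ nonCone)

∈-nonConeVertices⁺ : ∀ X → X ⁅ v ⁆ ≡ true → isCone X v ≡ false → v ∈ˡ nonConeVertices X
∈-nonConeVertices⁺ {v = v} X vertex nonCone =
  ∈-filter⁺ (nonCone? X) (∈-allFin v) (cong₂ _∧_ vertex (cong not nonCone))

lk≢del⁻ : ∀ a b c → (not a ∧ b ∧ c) ==ᴮ (not a ∧ b) ≡ false → a ≡ false × b ≡ true × c ≡ false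
lk≢del⁻ false true false _ = refl , refl , refl
lk≢del⁻ false true true ()
lk≢del⁻ false false _ ()
lk≢del⁻ true _ _ ()

isCone≡false⇒witness : (X : Family n) → isCone X v ≡ false →
                       ∃[ S ] v ∉ S × X S ≡ true × X (S [ v ]≔ inside) ≡ false
isCone≡false⇒witness {n = n} {v = v} X nonCone with all-false (allSubsets n) nonCone
... | S , lk≢del with lk≢del⁻ (lookup S v) _ _ lk≢del
... | S[v]≡false , XS , XS+v =
  S , (λ v∈S → case trans (sym S[v]≡false) (lookup-∈ v∈S) of λ ()) , XS , XS+v

witness⇒isCone≡false : ∀ X → v ∉ S → X S ≡ true → X (S [ v ]≔ inside) ≡ false →
                       isCone X v ≡ false
witness⇒isCone≡false {v = v} {S = S} X v∉S XS XS+v =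
  ¬-not λ cone → case trans (sym (all-sound cone (∈-allSubsets S))) lk≢del of λ ()
  where
  lk≢del : lk X v S ==ᴮ del X v S ≡ false
  lk≢del rewrite lookup-∉ v∉S | XS | XS+v = refl

non-cone-vertex⇒large-circuit : ∀ X → IsComplex X → w ∈ˡ nonConeVertices X →
                                ∃[ A ] IsCircuit X A × 1 < ∣ A ∣
non-cone-vertex⇒large-circuit {w = w} X complex w∈ with ∈-nonConeVertices⁻ X w∈
... | X⁅w⁆ , nonCone with isCone≡false⇒witness X nonCone
... | S , w∉S , XS , XS+w with non-face⇒⊇circuit (S [ w ]≔ inside) XS+w
... | A , A⊆S+w , circuit@(XA , _) =
  A , circuit , subst (_< ∣ A ∣) (∣⁅x⁆∣≡1 w) (p⊂q⇒∣p∣<∣q∣ ⁅w⁆⊂A)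
  where
  w∈A : w ∈ A
  w∈A = decidable-stable (w ∈? A) λ w∉A →
    case trans (sym (complex S A (⊆-insert⁻ A⊆S+w w∉A) XS)) XA of λ ()
  ⁅w⁆⊂A : ⁅ w ⁆ ⊂ A
  ⁅w⁆⊂A = ⊆∧≢⇒⊂ (x∈p⇒⁅x⁆⊆p w∈A) λ { refl → case trans (sym X⁅w⁆) XA of λ () }

large-circuit-meets-cover : {A : Subset n} → IsCircuitCover X C → IsCircuit X A → 1 < ∣ A ∣ →
                            Nonempty (A ∩ C)
large-circuit-meets-cover {n = n} {C = C} {A = A} cover circuit 1<∣A∣ with nonempty? (A ∩ C)
... | yes nonempty = nonempty
... | no empty =
  case subst (λ s → 2 ≤ suc s) ∣A∩C∣≡0 (≤-trans 1<∣A∣ (cover circuit)) of λ { (s≤s ()) }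
  where
  ∣A∩C∣≡0 : ∣ A ∩ C ∣ ≡ 0
  ∣A∩C∣≡0 = trans (cong ∣_∣ (Empty-unique empty)) (∣⊥∣≡0 n)

∈-large-circuit⇒non-cone : ∀ X → IsCircuit X A → 1 < ∣ A ∣ → u ∈ A → u ∈ˡ nonConeVertices X
∈-large-circuit⇒non-cone {A = A} {u = u} X (XA , proper) 1<∣A∣ u∈A =
  ∈-nonConeVertices⁺ X (proper ⁅u⁆⊂A)
    (witness⇒isCone≡false X ∉-remove (proper (remove-⊂ u∈A)) XA-u+u)
  where
  ⁅u⁆⊂A : ⁅ u ⁆ ⊂ A
  ⁅u⁆⊂A = ⊆∧≢⇒⊂ (x∈p⇒⁅x⁆⊆p u∈A) λ ⁅u⁆≡A →
    <-irrefl (sym (∣⁅x⁆∣≡1 u)) (subst (λ B → 1 < ∣ B ∣) (sym ⁅u⁆≡A) 1<∣A∣)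
  XA-u+u : X ((A [ u ]≔ outside) [ u ]≔ inside) ≡ false
  XA-u+u = trans (cong X (insert-remove u∈A)) XA

non-cone-vertex∈cover : ∀ X → IsComplex X → IsCircuitCover X C → w ∈ˡ nonConeVertices X →
                        ∃[ u ] u ∈ˡ nonConeVertices X × u ∈ C
non-cone-vertex∈cover {C = C} X complex cover w∈ with non-cone-vertex⇒large-circuit X complex w∈
... | A , circuit , 1<∣A∣ with large-circuit-meets-cover cover circuit 1<∣A∣
... | u , u∈A∩C with x∈p∩q⁻ A C u∈A∩C
... | u∈A , u∈C = u , ∈-large-circuit⇒non-cone X circuit 1<∣A∣ u∈A , u∈C

θ-fuel-suc-≤ : ∀ k (X : Family n) →
               (∀ {w} → w ∈ˡ nonConeVertices X →
                 ∃[ u ] u ∈ˡ nonConeVertices X × θ-fuel k (del X u) ⊔ suc (θ-fuel k (lk X u)) ≤ m) →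
               θ-fuel (suc k) X ≤ m
θ-fuel-suc-≤ k X branch with nonConeVertices X
... | [] = z≤n
... | _ ∷ _ with branch (here refl)
... | u , u∈ , ≤m = ≤-trans (minList-≤ _ (∈-map⁺ _ u∈)) ≤m

θ-fuel≤dimPlusOne : ∀ k X → IsComplex X → IsCircuitCover X C → θ-fuel k X ≤ dimPlusOne X C
θ-fuel≤dimPlusOne zero X _ _ = z≤n
θ-fuel≤dimPlusOne (suc k) X complex cover = θ-fuel-suc-≤ k X λ w∈ →
  case non-cone-vertex∈cover X complex cover w∈ of λ where
    (u , u∈ , u∈C) → u , u∈ , ⊔-lub
      (≤-trans (θ-fuel≤dimPlusOne k (del X u) (del-isComplex complex) (del-isCircuitCover cover))
               (del-dimPlusOne-≤ X))
      (≤-trans (s≤s (θ-fuel≤dimPlusOne k (lk X u) (lk-isComplex complex)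
                                        (lk-isCircuitCover complex cover u∈C)))
               (lk-dimPlusOne-< X (proj₁ (∈-nonConeVertices⁻ X u∈)) u∈C))

theorem10 : (n : ℕ) (X : Family n) → IsComplex X → θ X ≤ ccn X
theorem10 n X complex = ≤-ccn X (θ-fuel≤dimPlusOne n X complex)
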